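{- Let $k\ge1$ be an integer. (a) If $b=3k+1$, then $[2k+1,0,k+1]_b$, $[0,2k+1,k]_b$ and $[1,2k+1,k]_b$ are $1$-cycles of $S_{x^3,b}$. (b) If $b=3k+2$, then $[2k+1,0,k]_b$ is a $1$-cycle of $S_{x^3,b}$. (c) If $b=9k+3$, then $[6k+2,4k+2,5k+1]_b$ is a $1$-cycle of $S_{x^3,b}$. (d) If $b=9k+6$, then $[6k+4,2k+1,7k+5]_b$ is a $1$-cycle of $S_{x^3,b}$.
   Context: For an integer $b\ge2$, $[x_0,x_1,\dots,x_d]_b$ denotes the integer $x_0+x_1b+\dots+x_db^d$ (digits listed from least significant, $0\le x_i<b$). $S_{x^3,b}(n)=x_0^3+\dots+x_d^3$ where $n=[x_0,\dots,x_d]_b$ is the base-$b$ expansion of $n$. A $1$-cycle of $S_{x^3,b}$ is a positive integer $n$ with $S_{x^3,b}(n)=n$. -}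

module Defs where

open import Data.Nat using (ℕ; zero; suc; _+_; _*_; _^_; _≤_; NonZero)
open import Data.Nat.DivMod using (_/_; _%_)
open import Data.List using (List; []; _∷_; map)
open import Data.Nat.ListAction using (sum)
open import Data.Product using (_×_)
open import Relation.Binary.PropositionalEquality using (_≡_)

-- [x₀, x₁, …, x_d]_b = x₀ + x₁ b + … + x_d b^d  (digits from least significant)
fromDigits : ℕ → List ℕ → ℕ
fromDigits b []       = 0
fromDigits b (x ∷ xs) = x + b * fromDigits b xs

-- base-b expansion of n (least significant digit first), computed with fuel;
-- fuel n suffices for every b ≥ 2 since each step strictly decreases n
digitsFuel : (b : ℕ) → .{{NonZero b}} → ℕ → ℕ → List ℕ
digitsFuel b zero     n = []
digitsFuel b (suc f) zero = []
digitsFuel b (suc f) (suc m) = (suc m % b) ∷ digitsFuel b f (suc m / b)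

digits : (b : ℕ) → .{{NonZero b}} → ℕ → List ℕ
digits b n = digitsFuel b n n

S3 : (b : ℕ) → .{{NonZero b}} → ℕ → ℕ
S3 b n = sum (map (λ x → x ^ 3) (digits b n))

Is1Cycle : (b : ℕ) → .{{NonZero b}} → ℕ → Set
Is1Cycle b n = (1 ≤ n) × (S3 b n ≡ n)

{-# OPTIONS --safe #-}
-- Division with remainder recovers the digits of x₀ + b·m as x₀ followed by the digits of m, so
-- a digit list with entries below b and nonzero leading digit is the base-b expansion of its
-- value. A 1-cycle is then just such a list whose cubes sum to its value; for each family this
-- is a polynomial identity in k, while the digit bounds need k ≥ 1.
module Submission where

open import Defs
open import Data.Nat using (ℕ; zero; suc; _+_; _*_; _^_; _≤_; _<_; NonZero; z≤n; s≤s; >-nonZero; >-nonZero⁻¹; z<s)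
open import Data.Nat.Properties
open import Data.Nat.DivMod using (_%_; _/_; [m+kn]%n≡m%n; m<n⇒m%n≡m; m<n⇒m/n≡0; m*n/n≡m; +-distrib-/-∣ʳ)
open import Data.Nat.Divisibility using (divides)
open import Data.Nat.ListAction using (sum)
open import Data.List using (List; []; _∷_; map; length)
open import Function using (_∘_)
open import Data.Product using (_×_; _,_)
open import Relation.Binary.PropositionalEquality using (_≡_; refl; trans; cong; cong₂; module ≡-Reasoning)
open import Data.Nat.Tactic.RingSolver using (solve)

data CanonicalDigits (b : ℕ) : List ℕ → Set where
  leading : ∀ {x} → x < b → 0 < x → CanonicalDigits b (x ∷ [])
  _∷_   : ∀ {x xs} → x < b → CanonicalDigits b xs → CanonicalDigits b (x ∷ xs)

module _ (b : ℕ) .{{_ : NonZero b}} where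

  fromDigits-pos : ∀ {xs} → CanonicalDigits b xs → 0 < fromDigits b xs
  fromDigits-pos {x ∷ _} (leading _ x>0) = ≤-trans x>0 (m≤m+n x _)
  fromDigits-pos {x ∷ xs} (_ ∷ c) = ≤-trans b*v>0 (m≤n+m (b * v) x)
    where
    v = fromDigits b xs
    b*v>0 : 0 < b * v
    b*v>0 = ≤-trans (>-nonZero⁻¹ b) (m≤m*n b v {{>-nonZero (fromDigits-pos c)}})

  [x+b*m]%b≡x : ∀ {x} m → x < b → (x + b * m) % b ≡ x
  [x+b*m]%b≡x {x} m x<b rewrite *-comm b m = trans ([m+kn]%n≡m%n x m b) (m<n⇒m%n≡m x<b)

  [x+b*m]/b≡m : ∀ {x} m → x < b → (x + b * m) / b ≡ m
  [x+b*m]/b≡m {x} m x<b rewrite *-comm b m =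
    trans (+-distrib-/-∣ʳ x (divides m refl)) (cong₂ _+_ (m<n⇒m/n≡0 x<b) (m*n/n≡m m b))

  digitsFuel-suc : ∀ f {n} → 0 < n → digitsFuel b (suc f) n ≡ n % b ∷ digitsFuel b f (n / b)
  digitsFuel-suc f {suc _} _ = refl

  digitsFuel-cons : ∀ f {x} m → x < b → 0 < x + b * m →
                    digitsFuel b (suc f) (x + b * m) ≡ x ∷ digitsFuel b f m
  digitsFuel-cons f m x<b n>0 = trans (digitsFuel-suc f n>0)
    (cong₂ _∷_ ([x+b*m]%b≡x m x<b) (cong (digitsFuel b f) ([x+b*m]/b≡m m x<b)))

  digitsFuel-fromDigits : ∀ {xs} f → CanonicalDigits b xs → length xs ≤ f →
                          digitsFuel b f (fromDigits b xs) ≡ xs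
  digitsFuel-fromDigits (suc f) (leading x<b x>0) _ =
    trans (digitsFuel-cons f 0 x<b (fromDigits-pos (leading x<b x>0)))
          (cong (_ ∷_) (digitsFuel-zero f))
    where
    digitsFuel-zero : ∀ f → digitsFuel b f 0 ≡ []
    digitsFuel-zero zero    = refl
    digitsFuel-zero (suc f) = refl
  digitsFuel-fromDigits (suc f) (x<b ∷ c) (s≤s len≤f) =
    trans (digitsFuel-cons f _ x<b (fromDigits-pos (x<b ∷ c)))
          (cong (_ ∷_) (digitsFuel-fromDigits f c len≤f))

  -- `digits b n` runs on fuel n; this bound says the fuel never runs out.
  length≤fromDigits : ∀ {xs} → 2 ≤ b → CanonicalDigits b xs → length xs ≤ fromDigits b xs
  length≤fromDigits b≥2 (leading _ x>0) = ≤-trans x>0 (m≤m+n _ _)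
  length≤fromDigits {x ∷ xs} b≥2 (_ ∷ c) = begin
    suc (length xs)          ≤⟨ s≤s (length≤fromDigits b≥2 c) ⟩
    suc v                    ≤⟨ m<m+n v (fromDigits-pos c) ⟩
    v + v                    ≡⟨ cong (v +_) (+-identityʳ v) ⟨
    2 * v                    ≤⟨ *-monoˡ-≤ v b≥2 ⟩
    b * v                    ≤⟨ m≤n+m (b * v) x ⟩
    x + b * v                ∎
    where
    open ≤-Reasoning
    v = fromDigits b xs

  digits-fromDigits : ∀ {xs} → 2 ≤ b → CanonicalDigits b xs → digits b (fromDigits b xs) ≡ xs
  digits-fromDigits b≥2 c = digitsFuel-fromDigits _ c (length≤fromDigits b≥2 c)

  fromDigits-is1Cycle : ∀ {xs} → 2 ≤ b → CanonicalDigits b xs →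
                        sum (map (_^ 3) xs) ≡ fromDigits b xs → Is1Cycle b (fromDigits b xs)
  fromDigits-is1Cycle b≥2 c cubes≡n =
    fromDigits-pos c , trans (cong (sum ∘ map (_^ 3)) (digits-fromDigits b≥2 c)) cubes≡n

  threeDigit-is1Cycle : ∀ x₀ x₁ x₂ → 2 ≤ b → x₀ < b → x₁ < b → x₂ < b → 0 < x₂ →
                        x₀ * x₀ * x₀ + x₁ * x₁ * x₁ + x₂ * x₂ * x₂ ≡ x₀ + x₁ * b + x₂ * (b * b) →
                        Is1Cycle b (fromDigits b (x₀ ∷ x₁ ∷ x₂ ∷ []))
  threeDigit-is1Cycle x₀ x₁ x₂ b≥2 x₀<b x₁<b x₂<b x₂>0 eq =
    fromDigits-is1Cycle b≥2 (x₀<b ∷ x₁<b ∷ leading x₂<b x₂>0) (begin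
      -- `x ^ 3` unfolded, since the ring solver treats `_^_` as opaque
      x₀ * (x₀ * (x₀ * 1)) + (x₁ * (x₁ * (x₁ * 1)) + (x₂ * (x₂ * (x₂ * 1)) + 0))
        ≡⟨ solve (x₀ ∷ x₁ ∷ x₂ ∷ []) ⟩
      x₀ * x₀ * x₀ + x₁ * x₁ * x₁ + x₂ * x₂ * x₂
        ≡⟨ eq ⟩
      x₀ + x₁ * b + x₂ * (b * b)
        ≡⟨ solve (x₀ ∷ x₁ ∷ x₂ ∷ b ∷ []) ⟩
      x₀ + b * (x₁ + b * (x₂ + b * 0)) ∎)
    where open ≡-Reasoning

m+n≡o⇒m≤o : ∀ {m o} n → m + n ≡ o → m ≤ o
m+n≡o⇒m≤o {m} n refl = m≤m+n m n

-- With k = suc j, each bound x < b is witnessed by the gap b ∸ suc x, an affine expression in j.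
cycles-base-3k+1 : ∀ k → 1 ≤ k →
    Is1Cycle (1 + 3 * k) (fromDigits (1 + 3 * k) (2 * k + 1 ∷ 0 ∷ k + 1 ∷ []))
  × Is1Cycle (1 + 3 * k) (fromDigits (1 + 3 * k) (0 ∷ 2 * k + 1 ∷ k ∷ []))
  × Is1Cycle (1 + 3 * k) (fromDigits (1 + 3 * k) (1 ∷ 2 * k + 1 ∷ k ∷ []))
cycles-base-3k+1 (suc j) _ =
    threeDigit-is1Cycle (1 + 3 * suc j) (2 * suc j + 1) 0 (suc j + 1) (s≤s (s≤s z≤n))
      (m+n≡o⇒m≤o j (solve (j ∷ []))) (m+n≡o⇒m≤o (3 * j + 3) (solve (j ∷ [])))
      (m+n≡o⇒m≤o (2 * j + 1) (solve (j ∷ []))) z<s (solve (j ∷ []))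
  , threeDigit-is1Cycle (1 + 3 * suc j) 0 (2 * suc j + 1) (suc j) (s≤s (s≤s z≤n))
      (m+n≡o⇒m≤o (3 * j + 3) (solve (j ∷ []))) (m+n≡o⇒m≤o j (solve (j ∷ [])))
      (m+n≡o⇒m≤o (2 * j + 2) (solve (j ∷ []))) z<s (solve (j ∷ []))
  , threeDigit-is1Cycle (1 + 3 * suc j) 1 (2 * suc j + 1) (suc j) (s≤s (s≤s z≤n))
      (m+n≡o⇒m≤o (3 * j + 2) (solve (j ∷ []))) (m+n≡o⇒m≤o j (solve (j ∷ [])))
      (m+n≡o⇒m≤o (2 * j + 2) (solve (j ∷ []))) z<s (solve (j ∷ []))

cycle-base-3k+2 : ∀ k → 1 ≤ k →
  Is1Cycle (2 + 3 * k) (fromDigits (2 + 3 * k) (2 * k + 1 ∷ 0 ∷ k ∷ []))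
cycle-base-3k+2 (suc j) _ =
  threeDigit-is1Cycle (2 + 3 * suc j) (2 * suc j + 1) 0 (suc j) (s≤s (s≤s z≤n))
    (m+n≡o⇒m≤o (j + 1) (solve (j ∷ []))) (m+n≡o⇒m≤o (3 * j + 4) (solve (j ∷ [])))
    (m+n≡o⇒m≤o (2 * j + 3) (solve (j ∷ []))) z<s (solve (j ∷ []))

cycle-base-9k+3 : ∀ k → 1 ≤ k →
  Is1Cycle (3 + 9 * k) (fromDigits (3 + 9 * k) (6 * k + 2 ∷ 4 * k + 2 ∷ 5 * k + 1 ∷ []))
cycle-base-9k+3 (suc j) _ =
  threeDigit-is1Cycle (3 + 9 * suc j) (6 * suc j + 2) (4 * suc j + 2) (5 * suc j + 1) (s≤s (s≤s z≤n))
    (m+n≡o⇒m≤o (3 * j + 3) (solve (j ∷ []))) (m+n≡o⇒m≤o (5 * j + 5) (solve (j ∷ [])))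
    (m+n≡o⇒m≤o (4 * j + 5) (solve (j ∷ []))) z<s (solve (j ∷ []))

cycle-base-9k+6 : ∀ k → 1 ≤ k →
  Is1Cycle (6 + 9 * k) (fromDigits (6 + 9 * k) (6 * k + 4 ∷ 2 * k + 1 ∷ 7 * k + 5 ∷ []))
cycle-base-9k+6 (suc j) _ =
  threeDigit-is1Cycle (6 + 9 * suc j) (6 * suc j + 4) (2 * suc j + 1) (7 * suc j + 5) (s≤s (s≤s z≤n))
    (m+n≡o⇒m≤o (3 * j + 4) (solve (j ∷ []))) (m+n≡o⇒m≤o (7 * j + 11) (solve (j ∷ [])))
    (m+n≡o⇒m≤o (2 * j + 2) (solve (j ∷ []))) z<s (solve (j ∷ []))

proposition5p1 : (k : ℕ) → 1 ≤ k →
    (Is1Cycle (1 + 3 * k) (fromDigits (1 + 3 * k) (2 * k + 1 ∷ 0 ∷ k + 1 ∷ []))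
      × Is1Cycle (1 + 3 * k) (fromDigits (1 + 3 * k) (0 ∷ 2 * k + 1 ∷ k ∷ []))
      × Is1Cycle (1 + 3 * k) (fromDigits (1 + 3 * k) (1 ∷ 2 * k + 1 ∷ k ∷ [])))
    × Is1Cycle (2 + 3 * k) (fromDigits (2 + 3 * k) (2 * k + 1 ∷ 0 ∷ k ∷ []))
    × Is1Cycle (3 + 9 * k) (fromDigits (3 + 9 * k) (6 * k + 2 ∷ 4 * k + 2 ∷ 5 * k + 1 ∷ []))
    × Is1Cycle (6 + 9 * k) (fromDigits (6 + 9 * k) (6 * k + 4 ∷ 2 * k + 1 ∷ 7 * k + 5 ∷ []))
proposition5p1 k k≥1 =
    cycles-base-3k+1 k k≥1
  , cycle-base-3k+2 k k≥1
  , cycle-base-9k+3 k k≥1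
  , cycle-base-9k+6 k k≥1
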